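{- For every integer $b \ge 3$, $D(b) - D(b-1) = A(b)$, where $A(n)$ denotes the number of pairs $(i,j)$ of positive integers with $i < j$ and $\frac{j(j+1)}{2} - \frac{i(i+1)}{2} = n$ (the number of ways to write $n$ as a difference of two positive triangular numbers; OEIS A136107).
   Context: Base-$b$ generalized comma sequence with initial value $v \ge 1$: $a(1)=v$, and for $n>1$, with $x$ the least significant base-$b$ digit of $a(n-1)$, $a(n)=a(n-1)+bx+y$ where $y\in\{0,\dots,b-1\}$ must equal the most significant base-$b$ digit of $a(n)$ and is the smallest such; if none exists the sequence terminates. For $b \ge 2$, $D(b)$ denotes the number of positive integers $v \in [b^m - b^2, b^m)$ (for any fixed $m \ge 3$; this number does not depend on $m$) such that no term of the base-$b$ comma sequence with initial value $v$ is $\ge b^m$. -}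

module Defs where

open import Data.Nat using (ℕ; zero; suc; _+_; _*_; _∸_; _^_; _≤_; _<_)
open import Data.Product using (Σ; _×_; _,_)
open import Data.List using (List; length)
open import Data.List.Membership.Propositional using (_∈_)
open import Data.List.Relation.Unary.Unique.Propositional using (Unique)
open import Function.Bundles using (_⇔_)
open import Relation.Nullary using (¬_)
open import Relation.Binary.PropositionalEquality using (_≡_)

LSD : ℕ → ℕ → ℕ → Set
LSD b a x = x < b × Σ ℕ (λ q → a ≡ x + q * b)

-- y is the most significant base-b digit of n (n ≥ 1 is forced by 1 ≤ y)
MSD : ℕ → ℕ → ℕ → Set
MSD b n y = 1 ≤ y × y < b × Σ ℕ (λ k → y * b ^ k ≤ n × n < suc y * b ^ k)

-- one step of the base-b comma sequence: a' follows a
-- (a' = a + b x + y, y the smallest digit equal to the msd of a + b x + y)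
Step : ℕ → ℕ → ℕ → Set
Step b a a' =
  Σ ℕ λ x → LSD b a x ×
  Σ ℕ λ y → y < b × a' ≡ a + b * x + y × MSD b a' y ×
  (∀ y' → y' < y → ¬ MSD b (a + b * x + y') y')

data Term (b v : ℕ) : ℕ → Set where
  start : Term b v v
  next  : ∀ {a a'} → Term b v a → Step b a a' → Term b v a'

-- v counted by D(b) (for the parameter m)
Good : ℕ → ℕ → ℕ → Set
Good b m v = 1 ≤ v × b ^ m ∸ b ^ 2 ≤ v × v < b ^ m ×
             (∀ a → Term b v a → a < b ^ m)

tri : ℕ → ℕ
tri zero    = zero
tri (suc k) = suc k + tri k

TriDiff : ℕ → ℕ × ℕ → Set
TriDiff n (i , j) = 1 ≤ i × i < j × tri j ≡ tri i + n

HasSize : {A : Set} → (A → Set) → ℕ → Set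
HasSize {A} P k =
  Σ (List A) λ xs → Unique xs × (∀ x → (x ∈ xs) ⇔ P x) × length xs ≡ k

-- Write c for the base and B = c ^ m. Every a in the window [B − c², B) has leading digit
-- c − 1, so from such an a (last digit x) the sequence either steps to a + c x + (c − 1) < B,
-- jumps to a + c x + 1 ≥ B (leading digit 1), or stops. Unwinding this, v is counted by D(c)
-- exactly when v + c (tri j − tri i) = B + j − 1 for a pair 1 ≤ i < j < c with
-- tri j − tri i ≤ c: the orbit of v then has last digits j − 1, j − 2, …, i and stops below B.
-- Together with the pair (c − 1, c) these are all pairs whose triangular difference is at most
-- c, so D(c) + 1 = A(1) + ⋯ + A(c), and the theorem follows by taking differences.

module Submission where

open import Defs
open import Data.Nat
  using (ℕ; zero; suc; _+_; _*_; _∸_; _^_; _≤_; _<_; z≤n; s≤s; s≤s⁻¹; _≟_; _≤?_; _<?_; NonZero; >-nonZero)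
open import Data.Nat.DivMod using (_%_; _/_; m≡m%n+[m/n]*n; m%n<n; [m+kn]%n≡m%n; m<n⇒m%n≡m; [m+n]%n≡m%n)
open import Data.Nat.Properties
open import Algebra.Properties.CommutativeSemigroup +-commutativeSemigroup using (xy∙z≈xz∙y)
open import Data.Product using (Σ; ∃; _×_; _,_; proj₁; proj₂)
open import Data.Sum using (_⊎_; inj₁; inj₂)
open import Data.Empty using (⊥-elim)
open import Data.List using (List; []; _∷_; length; map; _++_; filter; cartesianProduct; upTo)
open import Data.List.Membership.Propositional using (_∈_)
open import Data.List.Membership.Propositional.Properties
open import Data.List.Membership.Propositional.Properties.WithK using (unique∧set⇒bag)
open import Data.List.Relation.Unary.Any using (here; there)
open import Data.List.Relation.Unary.Unique.Propositional using (Unique; []; _∷_)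
import Data.List.Relation.Unary.All as All
import Data.List.Relation.Unary.All.Properties as All
import Data.List.Relation.Unary.Unique.Propositional.Properties as Unique
open import Data.List.Relation.Binary.BagAndSetEquality using (∼bag⇒↭)
open import Data.List.Relation.Binary.Permutation.Propositional.Properties using (↭-length)
open import Data.List.Properties using (length-++; length-map)
open import Function.Bundles using (_⇔_; mk⇔; Equivalence)
open import Function.Properties.Equivalence using () renaming (sym to ⇔-sym)
open import Relation.Nullary using (¬_; yes; no)
open import Relation.Nullary.Decidable using (_×-dec_)
open import Relation.Unary using (Decidable)
open import Data.Nat.Tactic.RingSolver using (solve-∀)
open import Relation.Binary.PropositionalEquality
open import Relation.Binary.Definitions using (tri<; tri≈; tri>)

module _ {A : Set} where

  HasSize-unique : {P : A → Set} {m n : ℕ} → HasSize P m → HasSize P n → m ≡ n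
  HasSize-unique (xs , u , xs⇔P , refl) (ys , v , ys⇔P , refl) =
    ↭-length (∼bag⇒↭ (unique∧set⇒bag u v λ {x} →
      mk⇔ (λ x∈xs → Equivalence.from (ys⇔P x) (Equivalence.to (xs⇔P x) x∈xs))
          (λ x∈ys → Equivalence.from (xs⇔P x) (Equivalence.to (ys⇔P x) x∈ys))))

  HasSize-resp-⇔ : {P Q : A → Set} {n : ℕ} → (∀ x → P x ⇔ Q x) → HasSize P n → HasSize Q n
  HasSize-resp-⇔ P⇔Q (xs , u , xs⇔P , len) =
    xs , u , (λ x → mk⇔ (λ x∈xs → Equivalence.to (P⇔Q x) (Equivalence.to (xs⇔P x) x∈xs))
                        (λ q → Equivalence.from (xs⇔P x) (Equivalence.from (P⇔Q x) q))) , len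

  HasSize-⊎ : {P Q : A → Set} {m n : ℕ} → (∀ x → P x → ¬ Q x) →
              HasSize P m → HasSize Q n → HasSize (λ x → P x ⊎ Q x) (m + n)
  HasSize-⊎ {P} {Q} disjoint (xs , u , xs⇔P , refl) (ys , v , ys⇔Q , refl) =
    xs ++ ys ,
    Unique.++⁺ u v (λ (x∈xs , x∈ys) →
      disjoint _ (Equivalence.to (xs⇔P _) x∈xs) (Equivalence.to (ys⇔Q _) x∈ys)) ,
    (λ x → mk⇔ (to x) (from x)) , length-++ xs
    where
    to : ∀ x → x ∈ xs ++ ys → P x ⊎ Q x
    to x x∈ with ∈-++⁻ xs x∈
    ... | inj₁ x∈xs = inj₁ (Equivalence.to (xs⇔P x) x∈xs)
    ... | inj₂ x∈ys = inj₂ (Equivalence.to (ys⇔Q x) x∈ys)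
    from : ∀ x → P x ⊎ Q x → x ∈ xs ++ ys
    from x (inj₁ p) = ∈-++⁺ˡ (Equivalence.from (xs⇔P x) p)
    from x (inj₂ q) = ∈-++⁺ʳ xs (Equivalence.from (ys⇔Q x) q)

  HasSize-singleton : (a : A) → HasSize (_≡ a) 1
  HasSize-singleton a =
    a ∷ [] , All.[] ∷ [] , (λ x → mk⇔ (λ { (here x≡a) → x≡a ; (there ()) }) here) , refl

unique-map-injectiveOn : {A B : Set} (f : A → B) {xs : List A} →
  (∀ {x y} → x ∈ xs → y ∈ xs → f x ≡ f y → x ≡ y) → Unique xs → Unique (map f xs)
unique-map-injectiveOn f inj [] = []
unique-map-injectiveOn f inj (x≢xs ∷ u) =
  All.map⁺ (All.tabulate λ y∈xs fx≡fy → All.lookup x≢xs y∈xs (inj (here refl) (there y∈xs) fx≡fy)) ∷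
  unique-map-injectiveOn f (λ x∈ y∈ → inj (there x∈) (there y∈)) u

HasSize-image : {A B : Set} {P : A → Set} {n : ℕ} (f : A → B) →
                (∀ {x y} → P x → P y → f x ≡ f y → x ≡ y) →
                HasSize P n → HasSize (λ y → Σ A λ x → P x × y ≡ f x) n
HasSize-image f f-inj (xs , u , xs⇔P , refl) =
  map f xs ,
  unique-map-injectiveOn f (λ x∈ y∈ → f-inj (Equivalence.to (xs⇔P _) x∈) (Equivalence.to (xs⇔P _) y∈)) u ,
  (λ y → mk⇔ (λ y∈ → let (x , x∈xs , y≡fx) = ∈-map⁻ f y∈
                     in x , Equivalence.to (xs⇔P x) x∈xs , y≡fx)
             (λ { (x , px , refl) → ∈-map⁺ f (Equivalence.from (xs⇔P x) px) })) ,
  length-map f xs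

HasSize-boundedPairs : {P : ℕ × ℕ → Set} → Decidable P → (n : ℕ) →
  (∀ {i j} → P (i , j) → i < n × j < n) → ∃ λ k → HasSize P k
HasSize-boundedPairs {P} P? n bounded =
  length candidates , candidates ,
  Unique.filter⁺ P? {xs = grid} (Unique.cartesianProduct⁺ (Unique.upTo⁺ n) (Unique.upTo⁺ n)) ,
  (λ (i , j) → mk⇔ (λ p∈ → proj₂ (∈-filter⁻ P? {xs = grid} p∈))
                   (λ p → let (i<n , j<n) = bounded p in
                     ∈-filter⁺ P? (∈-cartesianProduct⁺ (∈-upTo⁺ i<n) (∈-upTo⁺ j<n)) p)) ,
  refl
  where
  grid = cartesianProduct (upTo n) (upTo n)
  candidates = filter P? grid

i<j⇒tri[i]+j≤tri[j] : ∀ {i j} → i < j → tri i + j ≤ tri j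
i<j⇒tri[i]+j≤tri[j] {i} {suc j} (s≤s i≤j) with m≤n⇒m<n∨m≡n i≤j
... | inj₂ refl = ≤-reflexive (+-comm (tri i) (suc i))
... | inj₁ i<j = begin
  tri i + suc j   ≡⟨ +-suc (tri i) j ⟩
  suc (tri i + j) ≤⟨ s≤s (i<j⇒tri[i]+j≤tri[j] i<j) ⟩
  suc (tri j)     ≤⟨ s≤s (m≤n+m (tri j) j) ⟩
  tri (suc j)     ∎
  where open ≤-Reasoning

tri-mono-< : ∀ {i j} → i < j → tri i < tri j
tri-mono-< {i} i<j = <-≤-trans (m<m+n (tri i) (<-≤-trans (s≤s z≤n) i<j)) (i<j⇒tri[i]+j≤tri[j] i<j)

tri-injective : ∀ {i j} → tri i ≡ tri j → i ≡ j
tri-injective {i} {j} eq with <-cmp i j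
... | tri< i<j _ _ = ⊥-elim (<⇒≢ (tri-mono-< i<j) eq)
... | tri≈ _ i≡j _ = i≡j
... | tri> _ _ j<i = ⊥-elim (<⇒≢ (tri-mono-< j<i) (sym eq))

LSD-% : ∀ b .{{_ : NonZero b}} a → LSD b a (a % b)
LSD-% b a = m%n<n a b , a / b , m≡m%n+[m/n]*n a b

LSD⇒≡% : ∀ {b a x} .{{_ : NonZero b}} → LSD b a x → x ≡ a % b
LSD⇒≡% {b} (x<b , q , refl) = sym (trans ([m+kn]%n≡m%n _ q b) (m<n⇒m%n≡m x<b))

m+kn≡o+ln⇒m%n≡o%n : ∀ m k o l n .{{_ : NonZero n}} → m + k * n ≡ o + l * n → m % n ≡ o % n
m+kn≡o+ln⇒m%n≡o%n m k o l n eq =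
  trans (sym ([m+kn]%n≡m%n m k n)) (trans (cong (_% n) eq) ([m+kn]%n≡m%n o l n))

powers-bracket-unique : ∀ b .{{_ : NonZero b}} {n k l} →
  b ^ k ≤ n → n < b ^ suc k → b ^ l ≤ n → n < b ^ suc l → k ≡ l
powers-bracket-unique b {n} {k} {l} lo₁ hi₁ lo₂ hi₂ with <-cmp k l
... | tri< k<l _ _ = ⊥-elim (<⇒≱ hi₁ (≤-trans (^-monoʳ-≤ b k<l) lo₂))
... | tri≈ _ k≡l _ = k≡l
... | tri> _ _ l<k = ⊥-elim (<⇒≱ hi₂ (≤-trans (^-monoʳ-≤ b l<k) lo₁))

digit-bracket : ∀ {b n y k} → 1 ≤ y → y < b → y * b ^ k ≤ n → n < suc y * b ^ k →
  b ^ k ≤ n × n < b ^ suc k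
digit-bracket {b} {n} {y} {k} 1≤y y<b lo hi =
  ≤-trans (m≤n*m (b ^ k) y {{>-nonZero 1≤y}}) lo , <-≤-trans hi (*-monoˡ-≤ (b ^ k) y<b)

MSD-unique : ∀ {b n y y′} → MSD b n y → MSD b n y′ → y ≡ y′
MSD-unique {suc b′} (1≤y , y<b , k , lo , hi) (1≤y′ , y′<b , l , lo′ , hi′)
  with digit-bracket {k = k} 1≤y y<b lo hi | digit-bracket {k = l} 1≤y′ y′<b lo′ hi′
... | (blo , bhi) | (blo′ , bhi′) with powers-bracket-unique (suc b′) {k = k} {l = l} blo bhi blo′ bhi′
... | refl = ≤-antisym (s≤s⁻¹ (*-cancelʳ-< _ _ _ (≤-<-trans lo hi′)))
                       (s≤s⁻¹ (*-cancelʳ-< _ _ _ (≤-<-trans lo′ hi)))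

b*x+y<b*b : ∀ {b x y} → x < b → y < b → b * x + y < b * b
b*x+y<b*b {b} {x} {y} x<b y<b = begin-strict
  b * x + y ≡⟨ +-comm (b * x) y ⟩
  y + b * x <⟨ +-monoˡ-< (b * x) y<b ⟩
  b + b * x ≡⟨ *-suc b x ⟨
  b * suc x ≤⟨ *-monoʳ-≤ b x<b ⟩
  b * b     ∎
  where open ≤-Reasoning

multiple-below-double : ∀ {n b} .{{_ : NonZero b}} → 0 < n → n < b + b → n % b ≡ 0 → n ≡ b
multiple-below-double {n} {b} 0<n n<2b n%b≡0 with n <? b
... | yes n<b = ⊥-elim (<⇒≢ 0<n (sym (trans (sym (m<n⇒m%n≡m n<b)) n%b≡0)))
... | no n≮b with m≤n⇒∃[o]m+o≡n (≮⇒≥ n≮b)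
... | r , refl = trans (cong (b +_) r≡0) (+-identityʳ b)
  where
  r≡0 : r ≡ 0
  r≡0 = begin
    r             ≡⟨ m<n⇒m%n≡m (+-cancelˡ-< b r b n<2b) ⟨
    r % b         ≡⟨ [m+n]%n≡m%n r b ⟨
    (r + b) % b   ≡⟨ cong (_% b) (+-comm r b) ⟩
    (b + r) % b   ≡⟨ n%b≡0 ⟩
    0             ∎
    where open ≡-Reasoning

term-prepend : ∀ {b v v′ a} → Step b v v′ → Term b v′ a → Term b v a
term-prepend s start = next start s
term-prepend s (next t s′) = next (term-prepend s t) s′

TriDiffAtMost : ℕ → ℕ × ℕ → Set
TriDiffAtMost n (i , j) = 1 ≤ i × i < j × tri j ≤ tri i + n

GoodPair : ℕ → ℕ × ℕ → Set
GoodPair c (i , j) = 1 ≤ i × i < j × j < c × tri j ≤ tri i + c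

tri[j]≤tri[i]+n⇒j≤n : ∀ {i j n} → i < j → tri j ≤ tri i + n → j ≤ n
tri[j]≤tri[i]+n⇒j≤n {i} i<j le = +-cancelˡ-≤ (tri i) _ _ (≤-trans (i<j⇒tri[i]+j≤tri[j] i<j) le)

tri[j]≤tri[i]+n⇒j<n : ∀ {i j n} → suc i < n → i < j → tri j ≤ tri i + n → j < n
tri[j]≤tri[i]+n⇒j<n {i} {suc j} {n} si<n i<sj le with m≤n⇒m<n∨m≡n (tri[j]≤tri[i]+n⇒j≤n i<sj le)
... | inj₁ j<n = j<n
... | inj₂ refl = ⊥-elim (<⇒≱ si<n (s≤s (≮⇒≥ i≮j)))
  where
  i≮j : ¬ i < j
  i≮j i<j = <⇒≱ (tri-mono-< i<j) (+-cancelˡ-≤ (suc j) _ _ (≤-trans le (≤-reflexive (+-comm (tri i) (suc j)))))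

TriDiffAtMost-suc : ∀ n p → TriDiffAtMost (suc n) p ⇔ (TriDiffAtMost n p ⊎ TriDiff (suc n) p)
TriDiffAtMost-suc n (i , j) = mk⇔ split join
  where
  split : TriDiffAtMost (suc n) (i , j) → TriDiffAtMost n (i , j) ⊎ TriDiff (suc n) (i , j)
  split (1≤i , i<j , le) with m≤n⇒m<n∨m≡n le
  ... | inj₁ lt = inj₁ (1≤i , i<j , +-cancelˡ-≤ 1 _ _ (≤-trans lt (≤-reflexive (+-suc (tri i) n))))
  ... | inj₂ eq = inj₂ (1≤i , i<j , eq)
  join : TriDiffAtMost n (i , j) ⊎ TriDiff (suc n) (i , j) → TriDiffAtMost (suc n) (i , j)
  join (inj₁ (1≤i , i<j , le)) = 1≤i , i<j , ≤-trans le (+-monoʳ-≤ (tri i) (n≤1+n n))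
  join (inj₂ (1≤i , i<j , eq)) = 1≤i , i<j , ≤-reflexive eq

TriDiffAtMost-GoodPair : ∀ e p →
  TriDiffAtMost (suc (suc e)) p ⇔ (GoodPair (suc (suc e)) p ⊎ p ≡ (suc e , suc (suc e)))
TriDiffAtMost-GoodPair e (i , j) = mk⇔ split join
  where
  c = suc (suc e)
  split : TriDiffAtMost c (i , j) → GoodPair c (i , j) ⊎ (i , j) ≡ (suc e , c)
  split (1≤i , i<j , le) with suc i <? c
  ... | yes si<c = inj₁ (1≤i , i<j , tri[j]≤tri[i]+n⇒j<n si<c i<j le , le)
  ... | no si≮c with ≤-antisym (s≤s⁻¹ (≤-trans i<j j≤c)) (s≤s⁻¹ (≮⇒≥ si≮c))
    where j≤c = tri[j]≤tri[i]+n⇒j≤n i<j le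
  ... | refl = inj₂ (cong (suc e ,_) (≤-antisym (tri[j]≤tri[i]+n⇒j≤n i<j le) i<j))
  join : GoodPair c (i , j) ⊎ (i , j) ≡ (suc e , c) → TriDiffAtMost c (i , j)
  join (inj₁ (1≤i , i<j , _ , le)) = 1≤i , i<j , le
  join (inj₂ refl) = s≤s z≤n , ≤-refl , ≤-reflexive (+-comm c (tri (suc e)))

GoodPair-finite : ∀ c → ∃ λ d → HasSize (GoodPair c) d
GoodPair-finite c = HasSize-boundedPairs
  (λ (i , j) → 1 ≤? i ×-dec (i <? j ×-dec (j <? c ×-dec (tri j ≤? tri i + c)))) c
  (λ (_ , i<j , j<c , _) → <-trans i<j j<c , j<c)

TriDiff-finite : ∀ n → ∃ λ a → HasSize (TriDiff n) a
TriDiff-finite n = HasSize-boundedPairs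
  (λ (i , j) → 1 ≤? i ×-dec (i <? j ×-dec (tri j ≟ tri i + n))) (suc n)
  (λ (_ , i<j , eq) → let j≤n = tri[j]≤tri[i]+n⇒j≤n i<j (≤-reflexive eq)
                      in <-≤-trans i<j (≤-trans j≤n (n≤1+n n)) , s≤s j≤n)

TriDiffAtMost-size-suc : ∀ {n m a} → HasSize (TriDiffAtMost n) m → HasSize (TriDiff (suc n)) a →
  HasSize (TriDiffAtMost (suc n)) (m + a)
TriDiffAtMost-size-suc {n} hm ha =
  HasSize-resp-⇔ (λ p → ⇔-sym (TriDiffAtMost-suc n p)) (HasSize-⊎ disjoint hm ha)
  where
  disjoint : ∀ p → TriDiffAtMost n p → ¬ TriDiff (suc n) p
  disjoint (i , j) (_ , _ , le) (_ , _ , eq) =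
    <-irrefl refl (≤-trans (≤-trans (≤-reflexive (sym (+-suc (tri i) n))) (≤-reflexive (sym eq))) le)

TriDiffAtMost-size : ∀ {e d} → HasSize (GoodPair (suc (suc e))) d → HasSize (TriDiffAtMost (suc (suc e))) (d + 1)
TriDiffAtMost-size {e} hd =
  HasSize-resp-⇔ (λ p → ⇔-sym (TriDiffAtMost-GoodPair e p)) (HasSize-⊎ disjoint hd (HasSize-singleton _))
  where
  disjoint : ∀ p → GoodPair (suc (suc e)) p → ¬ p ≡ (suc e , suc (suc e))
  disjoint _ (_ , _ , j<c , _) refl = <-irrefl refl j<c

module NearPower (e k : ℕ) where

  c : ℕ
  c = suc (suc e)

  P : ℕ
  P = c ^ suc (suc k)

  B : ℕ
  B = c * P

  c*c≤P : c * c ≤ P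
  c*c≤P = *-monoʳ-≤ c (≤-trans (≤-reflexive (sym (*-identityʳ c))) (*-monoʳ-≤ c (m^n>0 c k)))

  c*c<B : c * c < B
  c*c<B = ≤-<-trans c*c≤P (m<m+n P (≤-trans (m^n>0 c (suc (suc k))) (m≤m+n P (e * P))))

  window⇒leading-digit-range : ∀ {a} → B ≤ a + c * c → suc e * P ≤ a
  window⇒leading-digit-range {a} W = +-cancelˡ-≤ P _ _ (begin
    B          ≤⟨ W ⟩
    a + c * c  ≤⟨ +-monoʳ-≤ a c*c≤P ⟩
    a + P      ≡⟨ +-comm a P ⟩
    P + a      ∎)
    where open ≤-Reasoning

  MSD-top : ∀ {n} → suc e * P ≤ n → n < B → MSD c n (suc e)
  MSD-top lo hi = s≤s z≤n , ≤-refl , suc (suc k) , lo , hi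

  MSD-overflow : ∀ {n} → B ≤ n → n < B + B → MSD c n 1
  MSD-overflow {n} lo hi =
    ≤-refl , s≤s (s≤s z≤n) , suc (suc (suc k)) ,
    ≤-trans (≤-reflexive (+-identityʳ B)) lo , <-≤-trans hi (≤-reflexive (cong (B +_) (sym (+-identityʳ B))))

  candidate-MSD-top : ∀ {a} → B ≤ a + c * c → ∀ y → a + c * (a % c) + y < B →
    MSD c (a + c * (a % c) + y) (suc e)
  candidate-MSD-top {a} W y =
    MSD-top (≤-trans (window⇒leading-digit-range W) (≤-trans (m≤m+n a _) (m≤m+n _ y)))

  candidate<B+B : ∀ {a y} → a < B → y < c → a + c * (a % c) + y < B + B
  candidate<B+B {a} {y} a<B y<c = begin-strict
    a + c * (a % c) + y   ≡⟨ +-assoc a _ y ⟩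
    a + (c * (a % c) + y) <⟨ +-mono-< a<B (<-trans (b*x+y<b*b (m%n<n a c) y<c) c*c<B) ⟩
    B + B                 ∎
    where open ≤-Reasoning

  step-overflow : ∀ {a} → a < B → B ≤ a + c * (a % c) + 1 → Step c a (a + c * (a % c) + 1)
  step-overflow {a} a<B over =
    a % c , LSD-% c a , 1 , s≤s (s≤s z≤n) , refl , MSD-overflow over (candidate<B+B a<B (s≤s (s≤s z≤n))) ,
    λ y′ y′<1 msd → <⇒≱ y′<1 (proj₁ msd)

  step-top : ∀ {a} → B ≤ a + c * c → a + c * (a % c) + suc e < B → Step c a (a + c * (a % c) + suc e)
  step-top {a} W below =
    a % c , LSD-% c a , suc e , ≤-refl , refl , candidate-MSD-top W (suc e) below ,
    λ y′ y′<y msd →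
      <⇒≢ y′<y (MSD-unique msd (candidate-MSD-top W y′ (≤-<-trans (+-monoʳ-≤ _ (<⇒≤ y′<y)) below)))

  step-cases : ∀ {a a′} → B ≤ a + c * c → a < B → Step c a a′ →
    (B ≤ a + c * (a % c) + 1 × a′ ≡ a + c * (a % c) + 1) ⊎
    (a + c * (a % c) + suc e < B × a′ ≡ a + c * (a % c) + suc e)
  step-cases {a} W a<B (x , lsd , y , y<c , refl , msd , _) with LSD⇒≡% lsd
  ... | refl with a + c * (a % c) + y <? B
  ... | yes below with MSD-unique msd (candidate-MSD-top W y below)
  ... | refl = inj₂ (below , refl)
  step-cases {a} W a<B (x , lsd , y , y<c , refl , msd , _) | refl | no ¬below
    with MSD-unique msd (MSD-overflow (≮⇒≥ ¬below) (candidate<B+B a<B y<c))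
  ... | refl = inj₁ (≮⇒≥ ¬below , refl)

  -- The orbit of a has last digits j − 1, j − 2, …, i and stops after the term with digit i.
  Encodes : ℕ × ℕ → ℕ → Set
  Encodes (i , j) a = suc (a + c * tri j) ≡ B + j + c * tri i

  Encoded : ℕ → Set
  Encoded a = Σ (ℕ × ℕ) λ p → GoodPair c p × Encodes p a

  encodes-suc-⇔ : ∀ {i j a} → Encodes (i , suc j) a ⇔ Encodes (i , j) (a + c * j + suc e)
  encodes-suc-⇔ {i} {j} {a} = mk⇔
    (λ enc → suc-injective (trans (cong suc shift) (trans enc (cong (_+ c * tri i) (+-suc B j)))))
    (λ enc → trans (cong suc (sym shift)) (trans (cong suc enc) (cong (_+ c * tri i) (sym (+-suc B j)))))
    where
    shift : suc (a + c * j + suc e + c * tri j) ≡ a + c * tri (suc j)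
    shift = identity a j e (tri j)
      where
      identity : ∀ a j e t → suc (a + suc (suc e) * j + suc e + suc (suc e) * t) ≡ a + suc (suc e) * (suc j + t)
      identity = solve-∀

  encodes-after-lsd : ∀ {i j a x} → j < c → Encodes (i , j) (a + c * x + suc e) → a % c ≡ j
  encodes-after-lsd {i} {j} {a} {x} j<c enc =
    trans (m+kn≡o+ln⇒m%n≡o%n a (suc x + tri j) j (P + tri i) c eq) (m<n⇒m%n≡m j<c)
    where
    open ≡-Reasoning
    eq : a + (suc x + tri j) * c ≡ j + (P + tri i) * c
    eq = begin
      a + (suc x + tri j) * c                 ≡⟨ lhs a x e (tri j) ⟩
      suc (a + c * x + suc e + c * tri j)     ≡⟨ enc ⟩
      B + j + c * tri i                       ≡⟨ rhs P j e (tri i) ⟩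
      j + (P + tri i) * c                     ∎
      where
      lhs : ∀ a x e t → a + (suc x + t) * suc (suc e) ≡ suc (a + suc (suc e) * x + suc e + suc (suc e) * t)
      lhs = solve-∀
      rhs : ∀ p j e t → suc (suc e) * p + j + suc (suc e) * t ≡ j + (p + t) * suc (suc e)
      rhs = solve-∀

  encodes-lsd : ∀ {i j a} → j < c → Encodes (i , suc j) a → a % c ≡ j
  encodes-lsd {i} {j} {a} j<c enc = encodes-after-lsd {i} {j} {a} {j} j<c (Equivalence.to (encodes-suc-⇔ {i} {j} {a}) enc)

  encodes-no-overflow : ∀ {i j a} → GoodPair c (i , suc j) → Encodes (i , suc j) a → a + c * j + 1 < B
  encodes-no-overflow {i} {j} {a} (_ , i<sj , sj<c , _) enc =
    +-cancelʳ-≤ (suc j) _ _ (+-cancelʳ-≤ (c * tri i) _ _ (begin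
      suc (a + c * j + 1) + suc j + c * tri i   ≡⟨ reorder a (c * j) j (c * tri i) ⟩
      suc (a + c * j + suc (suc j)) + c * tri i ≤⟨ +-monoˡ-≤ (c * tri i) (s≤s (+-monoʳ-≤ (a + c * j) sj<c)) ⟩
      suc (a + c * j + c) + c * tri i           ≡⟨ collect a j e (tri i) ⟩
      suc (a + c * (tri i + suc j))
        ≤⟨ s≤s (+-monoʳ-≤ a (*-monoʳ-≤ c (i<j⇒tri[i]+j≤tri[j] i<sj))) ⟩
      suc (a + c * tri (suc j))                 ≡⟨ enc ⟩
      B + suc j + c * tri i                     ∎))
    where
    open ≤-Reasoning
    reorder : ∀ a d j t → suc (a + d + 1) + suc j + t ≡ suc (a + d + suc (suc j)) + t
    reorder = solve-∀
    collect : ∀ a j e t → suc (a + suc (suc e) * j + suc (suc e)) + suc (suc e) * t ≡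
                          suc (a + suc (suc e) * (t + suc j))
    collect = solve-∀

  encodes-halts : ∀ {i a} → 1 ≤ i → Encodes (i , suc i) a → B ≤ a + c * i + suc e
  encodes-halts {suc i} {a} _ enc =
    ≤-trans (m≤m+n B i) (≤-reflexive (suc-injective (trans (sym (+-suc B i)) (sym landing))))
    where
    landing : suc (a + c * suc i + suc e) ≡ B + suc i
    landing = +-cancelʳ-≡ (c * tri (suc i)) _ _ (Equivalence.to (encodes-suc-⇔ {suc i} {suc i} {a}) enc)

  encodes-window : ∀ {p a} → GoodPair c p → Encodes p a → B ≤ a + c * c × a < B
  encodes-window {i , suc j} {a} gp@(_ , _ , _ , le) enc =
    ≤-trans (m≤m+n B j) (s≤s⁻¹ (+-cancelʳ-≤ (c * tri i) _ _ (begin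
      suc (B + j) + c * tri i     ≡⟨ cong (_+ c * tri i) (+-suc B j) ⟨
      B + suc j + c * tri i       ≡⟨ enc ⟨
      suc (a + c * tri (suc j))   ≤⟨ s≤s (+-monoʳ-≤ a (*-monoʳ-≤ c le)) ⟩
      suc (a + c * (tri i + c))   ≡⟨ cong suc (distribute a c (tri i)) ⟩
      suc (a + c * c) + c * tri i ∎))) ,
    ≤-<-trans (≤-trans (m≤m+n a (c * j)) (m≤m+n _ 1)) (encodes-no-overflow gp enc)
    where
    open ≤-Reasoning
    distribute : ∀ a c t → a + c * (t + c) ≡ a + c * c + c * t
    distribute = solve-∀

  encodes-step : ∀ {p a a′} → GoodPair c p → Encodes p a → Step c a a′ → Encoded a′
  encodes-step {i , suc j} {a} gp@(1≤i , i<sj , sj<c , le) enc st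
    with encodes-lsd {i} {j} {a} (<-trans (n<1+n j) sj<c) enc
       | step-cases (proj₁ (encodes-window gp enc)) (proj₂ (encodes-window gp enc)) st
  ... | x≡j | inj₁ (overflow , _) =
    ⊥-elim (<⇒≱ (encodes-no-overflow gp enc) (subst (λ x → B ≤ a + c * x + 1) x≡j overflow))
  ... | x≡j | inj₂ (below , refl) with m≤n⇒m<n∨m≡n (s≤s⁻¹ i<sj)
  ...   | inj₁ i<j = (i , j) , (1≤i , i<j , <-trans (n<1+n j) sj<c , ≤-trans (m≤n+m (tri j) (suc j)) le) ,
                     subst (λ x → Encodes (i , j) (a + c * x + suc e)) (sym x≡j)
                       (Equivalence.to (encodes-suc-⇔ {i} {j} {a}) enc)
  ...   | inj₂ refl =
    ⊥-elim (<⇒≱ below (subst (λ x → B ≤ a + c * x + suc e) (sym x≡j) (encodes-halts 1≤i enc)))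

  encoded-orbit : ∀ {v a} → Encoded v → Term c v a → Encoded a
  encoded-orbit ev start = ev
  encoded-orbit ev (next t st) = let (p , gp , enc) = encoded-orbit ev t in encodes-step gp enc st

  m : ℕ
  m = suc (suc (suc k))

  window-⇔ : ∀ {v} → (c ^ m ∸ c ^ 2 ≤ v) ⇔ (B ≤ v + c * c)
  window-⇔ {v} = mk⇔
    (λ lo → ≤-trans (m≤n+m∸n B (c ^ 2)) (≤-trans (+-monoʳ-≤ (c ^ 2) lo) (≤-reflexive c²+v≡v+cc)))
    (λ W → m≤n+o⇒m∸n≤o B (c ^ 2) (≤-trans W (≤-reflexive (sym c²+v≡v+cc))))
    where
    c²+v≡v+cc : c ^ 2 + v ≡ v + c * c
    c²+v≡v+cc = trans (+-comm (c ^ 2) v) (cong (λ z → v + c * z) (*-identityʳ c))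

  Encoded⇒Good : ∀ {v} → Encoded v → Good c m v
  Encoded⇒Good {v} ev@(p , gp , enc) =
    positive v W ,
    Equivalence.from window-⇔ W ,
    proj₂ (encodes-window gp enc) ,
    λ a t → let (_ , gp′ , enc′) = encoded-orbit ev t in proj₂ (encodes-window gp′ enc′)
    where
    W : B ≤ v + c * c
    W = proj₁ (encodes-window gp enc)
    positive : ∀ v → B ≤ v + c * c → 1 ≤ v
    positive zero W = ⊥-elim (<⇒≱ c*c<B W)
    positive (suc v) _ = s≤s z≤n

  window⇒tri-bound : ∀ {i j a} → B ≤ a + c * c → j < c → Encodes (i , suc j) a → tri (suc j) ≤ tri i + c
  window⇒tri-bound {i} {j} {a} W j<c enc = ≮⇒≥ λ gt → <⇒≱ j<c (s≤s⁻¹ (+-cancelˡ-≤ (B + c * tri i) _ _ (begin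
    B + c * tri i + suc c               ≤⟨ +-monoˡ-≤ (suc c) (+-monoˡ-≤ (c * tri i) W) ⟩
    a + c * c + c * tri i + suc c       ≡⟨ expand a c (tri i) ⟩
    suc (a + c * suc (tri i + c))       ≤⟨ s≤s (+-monoʳ-≤ a (*-monoʳ-≤ c gt)) ⟩
    suc (a + c * tri (suc j))           ≡⟨ enc ⟩
    B + suc j + c * tri i               ≡⟨ xy∙z≈xz∙y B (suc j) (c * tri i) ⟩
    B + c * tri i + suc j               ∎)))
    where
    open ≤-Reasoning
    expand : ∀ a c t → a + c * c + c * t + suc c ≡ suc (a + c * suc (t + c))
    expand = solve-∀

  encoded-prev : ∀ {a} → B ≤ a + c * c → Encoded (a + c * (a % c) + suc e) → Encoded a
  encoded-prev {a} W ((i , j) , (1≤i , i<j , j<c , _) , enc) =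
    (i , suc j) , (1≤i , i<sj , tri[j]≤tri[i]+n⇒j<n (≤-<-trans i<j j<c) i<sj bound , bound) , enc′
    where
    i<sj : i < suc j
    i<sj = m<n⇒m<1+n i<j
    enc′ : Encodes (i , suc j) a
    enc′ = Equivalence.from (encodes-suc-⇔ {i} {j} {a})
      (subst (λ x → Encodes (i , j) (a + c * x + suc e)) (encodes-after-lsd {i} {j} {a} {a % c} j<c enc) enc)
    bound : tri (suc j) ≤ tri i + c
    bound = window⇒tri-bound {i} {j} {a} W j<c enc′

  halting-complement : ∀ {a u} → a + c * (a % c) + u ≡ B → 0 < u → u < c → a % c + u ≡ c
  halting-complement {a} {u} gap 0<u u<c =
    multiple-below-double (<-≤-trans 0<u (m≤n+m u x)) (+-mono-< (m%n<n a c) u<c)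
      (m+kn≡o+ln⇒m%n≡o%n (x + u) (a / c + x) 0 P c (begin
        x + u + (a / c + x) * c     ≡⟨ regroup x u (a / c) e ⟩
        x + a / c * c + c * x + u   ≡⟨ cong (λ z → z + c * x + u) (m≡m%n+[m/n]*n a c) ⟨
        a + c * x + u               ≡⟨ gap ⟩
        B                           ≡⟨ *-comm c P ⟩
        P * c                       ∎))
    where
    open ≡-Reasoning
    x = a % c
    regroup : ∀ x u q e → x + u + (q + x) * suc (suc e) ≡ x + q * suc (suc e) + suc (suc e) * x + u
    regroup = solve-∀

  encoded-halting : ∀ {a} → a + c * (a % c) + 1 < B → B ≤ a + c * (a % c) + suc e → Encoded a
  encoded-halting {a} lt ge = (x , suc x) , (1≤x , n<1+n x , sx<c , tri-step) , enc
    where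
    x = a % c
    u = B ∸ (a + c * x)
    gap : a + c * x + u ≡ B
    gap = m+[n∸m]≡n (≤-trans (m≤m+n _ 1) (<⇒≤ lt))
    2≤u : 2 ≤ u
    2≤u = +-cancelˡ-≤ (a + c * x) 2 u
      (≤-trans (≤-reflexive (+-suc (a + c * x) 1)) (≤-trans lt (≤-reflexive (sym gap))))
    u≤ : u ≤ suc e
    u≤ = +-cancelˡ-≤ (a + c * x) u (suc e) (≤-trans (≤-reflexive gap) ge)
    x+u≡c : x + u ≡ c
    x+u≡c = halting-complement {a} gap (≤-trans (s≤s z≤n) 2≤u) (s≤s u≤)
    1≤x : 1 ≤ x
    1≤x = +-cancelʳ-≤ u 1 x (≤-trans (s≤s u≤) (≤-reflexive (sym x+u≡c)))
    sx<c : suc x < c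
    sx<c = ≤-trans (≤-trans (+-monoˡ-≤ x 2≤u) (≤-reflexive (+-comm u x))) (≤-reflexive x+u≡c)
    tri-step : tri (suc x) ≤ tri x + c
    tri-step = ≤-trans (≤-reflexive (+-comm (suc x) (tri x))) (+-monoʳ-≤ (tri x) (<⇒≤ sx<c))
    open ≡-Reasoning
    enc : Encodes (x , suc x) a
    enc = begin
      suc (a + c * (suc x + tri x))       ≡⟨ expand a x e (tri x) ⟩
      suc (a + c * x + c + c * tri x)     ≡⟨ cong (λ z → suc (a + c * x + z + c * tri x)) x+u≡c ⟨
      suc (a + c * x + (x + u) + c * tri x) ≡⟨ regroup a (c * x) x u (c * tri x) ⟩
      a + c * x + u + suc x + c * tri x   ≡⟨ cong (λ z → z + suc x + c * tri x) gap ⟩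
      B + suc x + c * tri x               ∎
      where
      expand : ∀ a x e t → suc (a + suc (suc e) * (suc x + t)) ≡
                           suc (a + suc (suc e) * x + suc (suc e) + suc (suc e) * t)
      expand = solve-∀
      regroup : ∀ a d x u t → suc (a + d + (x + u) + t) ≡ a + d + u + suc x + t
      regroup = solve-∀

  Escapes : ℕ → Set
  Escapes a = Σ ℕ λ a′ → Term c a a′ × B ≤ a′

  -- Every step increases the term, so n with B ≤ a + n bounds the number of steps below B.
  encoded-or-escapes : ∀ n a → B ≤ a + n → a < B → B ≤ a + c * c → Encoded a ⊎ Escapes a
  encoded-or-escapes zero a B≤a a<B W = ⊥-elim (<⇒≱ a<B (≤-trans B≤a (≤-reflexive (+-identityʳ a))))
  encoded-or-escapes (suc n) a B≤a+n a<B W with B ≤? a + c * (a % c) + 1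
  ... | yes overflow = inj₂ (_ , next start (step-overflow a<B overflow) , overflow)
  ... | no ¬overflow with a + c * (a % c) + suc e <? B
  ...   | no ¬below = inj₁ (encoded-halting {a} (≰⇒> ¬overflow) (≮⇒≥ ¬below))
  ...   | yes below
    with encoded-or-escapes n a′ (≤-trans B≤a+n (≤-trans (≤-reflexive (+-suc a n)) (+-monoˡ-≤ n a<a′))) below
                           (≤-trans W (+-monoˡ-≤ (c * c) (<⇒≤ a<a′)))
    where
    a′ = a + c * (a % c) + suc e
    a<a′ : a < a′
    a<a′ = ≤-trans (s≤s (≤-trans (m≤m+n a _) (m≤m+n _ e))) (≤-reflexive (sym (+-suc _ e)))
  ...     | inj₁ ea′ = inj₁ (encoded-prev W ea′)
  ...     | inj₂ (z , t , B≤z) = inj₂ (z , term-prepend (step-top W below) t , B≤z)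

  Good⇒Encoded : ∀ {v} → Good c m v → Encoded v
  Good⇒Encoded {v} (_ , lo , v<B , bounded)
    with encoded-or-escapes B v (m≤n+m B v) v<B (Equivalence.to window-⇔ lo)
  ... | inj₁ ev = ev
  ... | inj₂ (z , t , B≤z) = ⊥-elim (<⇒≱ (bounded z t) B≤z)

  seed : ℕ × ℕ → ℕ
  seed (i , j) = B + j + c * tri i ∸ suc (c * tri j)

  encodes⇒≡seed : ∀ {p a} → Encodes p a → a ≡ seed p
  encodes⇒≡seed {i , j} {a} enc = sym (trans (cong (_∸ suc (c * tri j)) (sym enc)) (m+n∸n≡m a (c * tri j)))

  seed-encodes : ∀ {p} → GoodPair c p → Encodes p (seed p)
  seed-encodes {i , j} (_ , _ , _ , le) =
    trans (sym (+-suc (seed (i , j)) (c * tri j))) (m∸n+n≡m (begin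
      suc (c * tri j)       ≤⟨ s≤s (*-monoʳ-≤ c le) ⟩
      suc (c * (tri i + c)) ≡⟨ cong suc (*-distribˡ-+ c (tri i) c) ⟩
      suc (c * tri i + c * c) ≤⟨ +-monoʳ-< (c * tri i) c*c<B ⟩
      c * tri i + B         ≤⟨ +-monoʳ-≤ (c * tri i) (m≤m+n B j) ⟩
      c * tri i + (B + j)   ≡⟨ +-comm (c * tri i) (B + j) ⟩
      B + j + c * tri i     ∎))
    where open ≤-Reasoning

  encodes-injective : ∀ {p q a} → GoodPair c p → GoodPair c q → Encodes p a → Encodes q a → p ≡ q
  encodes-injective {i , suc j} {i′ , suc j′} {a} (_ , _ , sj<c , _) (_ , _ , sj′<c , _) enc enc′
    with trans (sym (encodes-lsd {i} {j} {a} (<-trans (n<1+n j) sj<c) enc))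
               (encodes-lsd {i′} {j′} {a} (<-trans (n<1+n j′) sj′<c) enc′)
  ... | refl = cong (_, suc j) (tri-injective (*-cancelˡ-≡ (tri i) (tri i′) c
                 (+-cancelˡ-≡ (B + suc j) _ _ (trans (sym enc) enc′))))

  Good-size : ∀ {d} → HasSize (GoodPair c) d → HasSize (Good c m) d
  Good-size hd = HasSize-resp-⇔
    (λ v → mk⇔ (λ (p , gp , v≡) → Encoded⇒Good (p , gp , subst (Encodes p) (sym v≡) (seed-encodes gp)))
               (λ good → let (p , gp , enc) = Good⇒Encoded good in p , gp , encodes⇒≡seed {p} enc))
    (HasSize-image seed
      (λ {p} {q} gp gq s≡ → encodes-injective {p} {q} {seed p} gp gq
                               (seed-encodes gp) (subst (Encodes q) (sym s≡) (seed-encodes gq)))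
      hd)

proposition2 : (b : ℕ) → 3 ≤ b → (m : ℕ) → 3 ≤ m →
    Σ ℕ λ d → Σ ℕ λ d' → Σ ℕ λ a →
      HasSize (Good b m) d × HasSize (Good (b ∸ 1) m) d' × HasSize (TriDiff b) a ×
      d ≡ d' + a
proposition2 _ (s≤s (s≤s (s≤s {n = e} _))) _ (s≤s (s≤s (s≤s {n = k} _))) =
  d , d′ , a , NearPower.Good-size (suc e) k hd , NearPower.Good-size e k hd′ , ha ,
  +-cancelʳ-≡ 1 d (d′ + a) (trans (HasSize-unique (TriDiffAtMost-size hd) atMost) (xy∙z≈xz∙y d′ 1 a))
  where
  d = proj₁ (GoodPair-finite (3 + e))
  hd = proj₂ (GoodPair-finite (3 + e))
  d′ = proj₁ (GoodPair-finite (2 + e))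
  hd′ = proj₂ (GoodPair-finite (2 + e))
  a = proj₁ (TriDiff-finite (3 + e))
  ha = proj₂ (TriDiff-finite (3 + e))
  atMost : HasSize (TriDiffAtMost (3 + e)) (d′ + 1 + a)
  atMost = TriDiffAtMost-size-suc (TriDiffAtMost-size hd′) ha
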